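{- Let $d$ be a degree sequence and let $\mathcal{F}(d)$ be the subgraph of the realization graph $\mathcal{G}(d)$ induced by the forests with degree sequence $d$. Then $\mathcal{F}(d)$ is connected. Equivalently, for any two forests $F,F'$ on the vertex set $\{1,\dots,n\}$ with the same degree sequence, there is a finite sequence of 2-switches transforming $F$ into $F'$ such that every intermediate graph is a forest.
   Context: All graphs are finite and simple. For a graph $G$ with $V(G)=\{1,\dots,n\}$, its degree sequence is $d(G)=(d_1,\dots,d_n)$ where $d_v$ is the degree of $v$. A 2-switch on $G$ is specified by four distinct vertices $a,b,c,d$ with $ab,cd\in E(G)$ and $ac,bd\notin E(G)$; it produces $G-ab-cd+ac+bd$ (same degree sequence). The realization graph $\mathcal{G}(d)$ has as vertices all graphs on $\{1,\dots,n\}$ with degree sequence $d$, two graphs being adjacent if one is obtained from the other by a single 2-switch. -}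

module Defs where

open import Data.Nat using (ℕ; _+_; _≤_)
open import Data.Bool using (Bool; true; false; if_then_else_; _∨_; _∧_; not)
open import Data.Fin using (Fin; _≟_)
open import Data.List using (List; []; _∷_; length; map; sum)
open import Data.List.Relation.Unary.AllPairs using (AllPairs)
open import Data.List.Base using (filter)
open import Data.Product using (Σ; _×_; ∃; _,_)
open import Relation.Binary.PropositionalEquality using (_≡_; _≢_)
open import Relation.Nullary.Decidable using (⌊_⌋)
open import Relation.Binary.Construct.Closure.ReflexiveTransitive using (Star)
open import Data.List using (allFin)

record Graph (n : ℕ) : Set where
  field
    adj    : Fin n → Fin n → Bool
    sym    : ∀ u v → adj u v ≡ adj v u
    irrefl : ∀ v → adj v v ≡ false
open Graph public

degree : ∀ {n} → Graph n → Fin n → ℕ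
degree {n} G v = length (filter (λ u → adj G v u Data.Bool.≟ true) (allFin n))

SameDegSeq : ∀ {n} → Graph n → Graph n → Set
SameDegSeq G H = ∀ v → degree G v ≡ degree H v

data Walk {n} (G : Graph n) : List (Fin n) → Set where
  single : ∀ v → Walk G (v ∷ [])
  step   : ∀ u v vs → adj G u v ≡ true → Walk G (v ∷ vs) → Walk G (u ∷ v ∷ vs)

-- a cycle: distinct vertices v₀,v₁,…,v_k (k ≥ 2), consecutive ones adjacent
-- and v_k adjacent to v₀
HasCycle : ∀ {n} → Graph n → Set
HasCycle {n} G =
  Σ (Fin n) λ v₀ → Σ (List (Fin n)) λ rest → Σ (Fin n) λ vk →
    let vs = v₀ ∷ (rest Data.List.++ (vk ∷ [])) in
    (2 ≤ length vs Data.Nat.∸ 1) × AllPairs _≢_ vs × Walk G vs × adj G vk v₀ ≡ true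

IsForest : ∀ {n} → Graph n → Set
IsForest G = HasCycle G → Data.Empty.⊥
  where import Data.Empty

_==_ : ∀ {n} → Fin n → Fin n → Bool
u == v = ⌊ u ≟ v ⌋

samePair : ∀ {n} → Fin n → Fin n → Fin n → Fin n → Bool
samePair x y p q = ((x == p) ∧ (y == q)) ∨ ((x == q) ∧ (y == p))

-- adjacency of G - ab - cd + ac + bd
switchedAdj : ∀ {n} → Graph n → Fin n → Fin n → Fin n → Fin n → Fin n → Fin n → Bool
switchedAdj G a b c d x y =
  if samePair x y a b ∨ samePair x y c d then false
  else if samePair x y a c ∨ samePair x y b d then true
  else adj G x y

TwoSwitch : ∀ {n} → Graph n → Graph n → Set
TwoSwitch {n} G H =
  Σ (Fin n) λ a → Σ (Fin n) λ b → Σ (Fin n) λ c → Σ (Fin n) λ d →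
    AllPairs _≢_ (a ∷ b ∷ c ∷ d ∷ []) ×
    adj G a b ≡ true × adj G c d ≡ true ×
    adj G a c ≡ false × adj G b d ≡ false ×
    (∀ x y → adj H x y ≡ switchedAdj G a b c d x y)

-- an edge of the induced subgraph 𝓕(d) of the realization graph:
-- a 2-switch between two forests
ForestSwitch : ∀ {n} → Graph n → Graph n → Set
ForestSwitch G H = IsForest G × IsForest H × TwoSwitch G H

SameGraph : ∀ {n} → Graph n → Graph n → Set
SameGraph G H = ∀ x y → adj G x y ≡ adj H x y

-- Induction on the number of vertices of F′ that carry an edge. Take a leaf v of F′ with
-- neighbour w, chosen so that w has a second neighbour unless F′ is a matching. By the degree
-- condition v is also a leaf of F, say at u. If u ≠ w, some neighbour x of w in F lies outside
-- the component of u in F − wx (this is where the choice of w is used), and the 2-switch of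
-- vu, wx into vw, ux keeps F a forest. Now vw is a pendant edge of both forests: delete it,
-- connect the smaller forests by induction, and replay those switches with vw put back, which
-- is harmless because v stays isolated throughout.

module Submission where

open import Defs hiding (sym)
open import Data.Nat using (ℕ; zero; suc; _+_; _≤_; _<_; z≤n; s≤s)
open import Data.Nat.Properties as ℕ using ()
open import Data.Bool using (Bool; true; false; if_then_else_; _∨_; _∧_; not)
open import Data.Bool.Properties
  using (∨-comm; ∧-comm; ∧-conicalˡ; ∧-conicalʳ; ∨-zeroʳ; ∨-identityʳ; ∧-identityʳ; ∧-zeroʳ; ¬-not)
open import Data.Fin using (Fin; _≟_)
import Data.Fin as Fin
open import Data.Fin.Properties using (suc-injective; injective⇒≤) renaming (any? to any?ᶠ)
open import Data.List using (List; []; _∷_; length; filter; tabulate; allFin; _++_; lookup)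
open import Data.List.Properties using (length-++; ++-assoc; length-tabulate; filter-notAll)
open import Data.List.Relation.Unary.AllPairs using (AllPairs; []; _∷_)
open import Data.List.Relation.Unary.All using (All; []; _∷_)
open import Data.List.Relation.Unary.All.Properties using (¬Any⇒All¬; ++⁻ˡ; ++⁻ʳ)
import Data.List.Relation.Unary.All as All
open import Data.List.Relation.Unary.Any using (here; there; any?)
import Data.List.Relation.Unary.Any as Any
open import Data.List.Membership.Propositional using (_∈_)
open import Data.List.Membership.Propositional.Properties using (∈-lookup; ∈-∃++; ∈-filter⁺; ∈-allFin)
open import Data.Product using (Σ; _×_; ∃; ∃₂; _,_; proj₁; proj₂)
open import Data.Sum using (_⊎_; inj₁; inj₂)
import Data.Sum as Sum
open import Data.Empty using (⊥-elim)
open import Function using (_∘_; id; case_of_)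
open import Relation.Nullary using (¬_; ¬?; Dec; yes; no; does; proof; Reflects; invert; contradiction)
open import Relation.Nullary.Decidable using (_×-dec_; _⊎-dec_; map′; isYes≗does; dec-true; dec-false)
open import Relation.Binary.PropositionalEquality
  using (_≡_; _≢_; refl; sym; trans; cong; cong₂; subst; ≢-sym)
open import Relation.Binary.Construct.Closure.ReflexiveTransitive using (Star; ε; _◅_; _◅◅_)
import Relation.Binary.Construct.Closure.ReflexiveTransitive as Star

private variable
  n : ℕ

SamePair : Fin n → Fin n → Fin n → Fin n → Set
SamePair x y p q = (x ≡ p × y ≡ q) ⊎ (x ≡ q × y ≡ p)

samePair? : (x y p q : Fin n) → Dec (SamePair x y p q)
samePair? x y p q = (x ≟ p ×-dec y ≟ q) ⊎-dec (x ≟ q ×-dec y ≟ p)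

samePair≡does : (x y p q : Fin n) → samePair x y p q ≡ does (samePair? x y p q)
samePair≡does x y p q =
  cong₂ _∨_ (cong₂ _∧_ (isYes≗does (x ≟ p)) (isYes≗does (y ≟ q)))
            (cong₂ _∧_ (isYes≗does (x ≟ q)) (isYes≗does (y ≟ p)))

module _ {x y p q : Fin n} where

  samePair-true : SamePair x y p q → samePair x y p q ≡ true
  samePair-true s = trans (samePair≡does x y p q) (dec-true (samePair? x y p q) s)

  samePair-false : ¬ SamePair x y p q → samePair x y p q ≡ false
  samePair-false ¬s = trans (samePair≡does x y p q) (dec-false (samePair? x y p q) ¬s)

  samePair-false⁻ : samePair x y p q ≡ false → ¬ SamePair x y p q
  samePair-false⁻ e s with () ← trans (sym e) (samePair-true s)

  samePair-sound : samePair x y p q ≡ true → SamePair x y p q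
  samePair-sound e =
    invert (subst (Reflects _) (trans (sym (samePair≡does x y p q)) e) (proof (samePair? x y p q)))

samePair-sym : (x y p q : Fin n) → samePair x y p q ≡ samePair y x p q
samePair-sym x y p q
  rewrite ∧-comm (x == p) (y == q) | ∧-comm (x == q) (y == p) = ∨-comm (y == q ∧ x == p) (y == p ∧ x == q)

samePair-swap : (x y p q : Fin n) → samePair x y p q ≡ samePair x y q p
samePair-swap x y p q = ∨-comm (x == p ∧ y == q) (x == q ∧ y == p)

samePair-trans : {a b x y u v : Fin n} → SamePair a b u v → SamePair x y u v → SamePair a b x y
samePair-trans (inj₁ (refl , refl)) (inj₁ (refl , refl)) = inj₁ (refl , refl)
samePair-trans (inj₁ (refl , refl)) (inj₂ (refl , refl)) = inj₂ (refl , refl)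
samePair-trans (inj₂ (refl , refl)) (inj₁ (refl , refl)) = inj₂ (refl , refl)
samePair-trans (inj₂ (refl , refl)) (inj₂ (refl , refl)) = inj₁ (refl , refl)

samePair-other : {x y z v w : Fin n} → SamePair x y v w → SamePair x z v w → z ≡ y
samePair-other (inj₁ (refl , refl)) (inj₁ (_ , refl))    = refl
samePair-other (inj₁ (refl , refl)) (inj₂ (refl , refl)) = refl
samePair-other (inj₂ (refl , refl)) (inj₁ (refl , refl)) = refl
samePair-other (inj₂ (refl , refl)) (inj₂ (_ , refl))    = refl

¬samePairˡ : {x y p q : Fin n} → x ≢ p → x ≢ q → ¬ SamePair x y p q
¬samePairˡ x≢p x≢q (inj₁ (x≡p , _)) = x≢p x≡p
¬samePairˡ x≢p x≢q (inj₂ (x≡q , _)) = x≢q x≡q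

¬samePairʳ : {x y p q : Fin n} → y ≢ p → y ≢ q → ¬ SamePair x y p q
¬samePairʳ y≢p y≢q (inj₁ (_ , y≡q)) = y≢q y≡q
¬samePairʳ y≢p y≢q (inj₂ (_ , y≡p)) = y≢p y≡p

¬samePair-loop : {x p q : Fin n} → p ≢ q → ¬ SamePair x x p q
¬samePair-loop p≢q (inj₁ (refl , refl)) = p≢q refl
¬samePair-loop p≢q (inj₂ (refl , refl)) = p≢q refl

¬samePair-through : {x y v w p q : Fin n} → SamePair x y v w → v ≢ p → v ≢ q → ¬ SamePair x y p q
¬samePair-through (inj₁ (refl , _)) v≢p v≢q = ¬samePairˡ v≢p v≢q
¬samePair-through (inj₂ (_ , refl)) v≢p v≢q = ¬samePairʳ v≢p v≢q

lookup-injective : {A : Set} {xs : List A} → AllPairs _≢_ xs →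
                   ∀ {i j} → lookup xs i ≡ lookup xs j → i ≡ j
lookup-injective (_ ∷ _)        {Fin.zero}  {Fin.zero}  _ = refl
lookup-injective (x∉ ∷ _)       {Fin.zero}  {Fin.suc j} x≡ = contradiction x≡ (All.lookup x∉ (∈-lookup j))
lookup-injective (x∉ ∷ _)       {Fin.suc i} {Fin.zero}  ≡x =
  contradiction (sym ≡x) (All.lookup x∉ (∈-lookup i))
lookup-injective (_ ∷ distinct) {Fin.suc i} {Fin.suc j} eq = cong Fin.suc (lookup-injective distinct eq)

distinct⇒length≤ : {vs : List (Fin n)} → AllPairs _≢_ vs → length vs ≤ n
distinct⇒length≤ distinct = injective⇒≤ (lookup-injective distinct)

distinct-last : {A : Set} (xs : List A) {z : A} → AllPairs _≢_ (xs ++ z ∷ []) → All (_≢ z) xs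
distinct-last []       _                = []
distinct-last (x ∷ xs) (x∉ ∷ distinct) with x≢z ∷ [] ← ++⁻ʳ xs x∉ = x≢z ∷ distinct-last xs distinct

allPairs-prefix : {A : Set} {R : A → A → Set} (xs : List A) {ys : List A} →
                  AllPairs R (xs ++ ys) → AllPairs R xs
allPairs-prefix []       _              = []
allPairs-prefix (x ∷ xs) (x∉ ∷ distinct) = ++⁻ˡ xs x∉ ∷ allPairs-prefix xs distinct

1≤length-∷ʳ : {A : Set} (xs : List A) {z : A} → 1 ≤ length (xs ++ z ∷ [])
1≤length-∷ʳ xs = subst (1 ≤_) (sym (length-++ xs)) (ℕ.m≤n+m 1 (length xs))

∈⇒1≤length : {A : Set} {x : A} {xs : List A} → x ∈ xs → 1 ≤ length xs
∈⇒1≤length (here _)  = s≤s z≤n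
∈⇒1≤length (there _) = s≤s z≤n

count : (Fin n → Bool) → ℕ
count {zero}  p = 0
count {suc n} p = (if p Fin.zero then 1 else 0) + count (p ∘ Fin.suc)

length-filter-tabulate : ∀ {m} (p : Fin m → Bool) (f : Fin n → Fin m) →
                         length (filter (λ u → p u Data.Bool.≟ true) (tabulate f)) ≡ count (p ∘ f)
length-filter-tabulate {zero}  p f = refl
length-filter-tabulate {suc n} p f with p (f Fin.zero)
... | true  = cong suc (length-filter-tabulate p (f ∘ Fin.suc))
... | false = length-filter-tabulate p (f ∘ Fin.suc)

degree≡count : (G : Graph n) (v : Fin n) → degree G v ≡ count (adj G v)
degree≡count G v = length-filter-tabulate (adj G v) id

count-cong : {p q : Fin n → Bool} → (∀ i → p i ≡ q i) → count p ≡ count q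
count-cong {zero}  p≗q = refl
count-cong {suc n} p≗q rewrite p≗q Fin.zero = cong (_ +_) (count-cong (p≗q ∘ Fin.suc))

count-remove : {p q : Fin n → Bool} (i : Fin n) → p i ≡ true → q i ≡ false →
               (∀ j → j ≢ i → p j ≡ q j) → count p ≡ suc (count q)
count-remove {suc n} {p} {q} Fin.zero pi qi p≗q rewrite pi | qi =
  cong suc (count-cong (λ j → p≗q (Fin.suc j) λ ()))
count-remove {suc n} {p} {q} (Fin.suc i) pi qi p≗q rewrite p≗q Fin.zero (λ ()) =
  trans (cong (_ +_) (count-remove i pi qi (λ j j≢i → p≗q (Fin.suc j) (j≢i ∘ suc-injective))))
        (ℕ.+-suc _ _)

erase : (Fin n → Bool) → Fin n → Fin n → Bool
erase p i j = if j == i then false else p j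

module _ (p : Fin n → Bool) {i : Fin n} where

  erase-self : erase p i i ≡ false
  erase-self with i ≟ i
  ... | yes _   = refl
  ... | no i≢i  = contradiction refl i≢i

  erase-≢ : ∀ {j} → j ≢ i → erase p i j ≡ p j
  erase-≢ {j} j≢i with j ≟ i
  ... | yes j≡i = contradiction j≡i j≢i
  ... | no _    = refl

  erase-true⁻ : ∀ {j} → erase p i j ≡ true → j ≢ i × p j ≡ true
  erase-true⁻ {j} e with j ≟ i
  ... | no j≢i = j≢i , e

  count-erase : p i ≡ true → count p ≡ suc (count (erase p i))
  count-erase pi = count-remove i pi erase-self (λ j j≢i → sym (erase-≢ j≢i))

true⇒1≤count : (p : Fin n → Bool) {i : Fin n} → p i ≡ true → 1 ≤ count p
true⇒1≤count p pi rewrite count-erase p pi = s≤s z≤n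

1≤count⇒true : {p : Fin n → Bool} → 1 ≤ count p → ∃ λ i → p i ≡ true
1≤count⇒true {suc n} {p} le with p Fin.zero in p0
... | true  = Fin.zero , p0
... | false with i , pi ← 1≤count⇒true {p = p ∘ Fin.suc} le = Fin.suc i , pi

twoTrue⇒2≤count : (p : Fin n → Bool) {i j : Fin n} → i ≢ j → p i ≡ true → p j ≡ true → 2 ≤ count p
twoTrue⇒2≤count p {i} i≢j pi pj rewrite count-erase p pi =
  s≤s (true⇒1≤count (erase p i) (trans (erase-≢ p (≢-sym i≢j)) pj))

2≤count⇒twoTrue : {p : Fin n → Bool} → 2 ≤ count p →
                  ∃₂ λ i j → i ≢ j × p i ≡ true × p j ≡ true
2≤count⇒twoTrue {p = p} le
  with i , pi ← 1≤count⇒true (ℕ.≤-trans (s≤s z≤n) le)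
  with j , ej ← 1≤count⇒true {p = erase p i} (ℕ.≤-pred (subst (2 ≤_) (count-erase p pi) le))
  with j≢i , pj ← erase-true⁻ p ej = i , j , ≢-sym j≢i , pi , pj

uniqueTrue⇒count≡1 : (p : Fin n → Bool) {i : Fin n} →
                     p i ≡ true → (∀ j → p j ≡ true → j ≡ i) → count p ≡ 1
uniqueTrue⇒count≡1 p {i} pi unique =
  trans (count-erase p pi) (cong suc (ℕ.n<1⇒n≡0 (ℕ.≰⇒> erased-empty)))
  where
  erased-empty : ¬ 1 ≤ count (erase p i)
  erased-empty le with j , ej ← 1≤count⇒true le with j≢i , pj ← erase-true⁻ p ej = j≢i (unique j pj)

count≡1⇒uniqueTrue : {p : Fin n → Bool} → count p ≡ 1 →
                     ∃ λ i → p i ≡ true × (∀ j → p j ≡ true → j ≡ i)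
count≡1⇒uniqueTrue {p = p} c≡1 with i , pi ← 1≤count⇒true (ℕ.≤-reflexive (sym c≡1)) = i , pi , unique
  where
  unique : ∀ j → p j ≡ true → j ≡ i
  unique j pj with j ≟ i
  ... | yes j≡i = j≡i
  ... | no j≢i with s≤s () ← subst (2 ≤_) c≡1 (twoTrue⇒2≤count p j≢i pj pi)

count-swap : {p q : Fin n → Bool} (i j : Fin n) → i ≢ j → p i ≡ true → p j ≡ false →
             q i ≡ false → q j ≡ true → (∀ k → k ≢ i → k ≢ j → p k ≡ q k) → count p ≡ count q
count-swap {p = p} {q} i j i≢j pi pj qi qj p≗q =
  trans (count-erase p pi) (sym (count-remove j qj (trans (erase-≢ p (≢-sym i≢j)) pj) q≗erase))
  where
  q≗erase : ∀ k → k ≢ j → q k ≡ erase p i k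
  q≗erase k k≢j with k ≟ i
  ... | yes refl = qi
  ... | no k≢i   = sym (p≗q k k≢i k≢j)

-- Edges, neighbours and degrees

-- A record rather than a synonym for adj G x y ≡ true, so that Agda can infer G from an edge.
record Edge (G : Graph n) (x y : Fin n) : Set where
  constructor edge
  field isEdge : adj G x y ≡ true
open Edge

_⊆_ : Graph n → Graph n → Set
G ⊆ H = ∀ {x y} → Edge G x y → Edge H x y

Connected : Graph n → Fin n → Fin n → Set
Connected G = Star (Edge G)

module _ {G : Graph n} where

  edge-sym : ∀ {x y} → Edge G x y → Edge G y x
  edge-sym {x} {y} (edge e) = edge (trans (Graph.sym G y x) e)

  edge⇒≢ : ∀ {x y} → Edge G x y → x ≢ y
  edge⇒≢ {x} (edge e) refl with () ← trans (sym (Graph.irrefl G x)) e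

  connected-sym : ∀ {x y} → Connected G x y → Connected G y x
  connected-sym = Star.reverse edge-sym

connected-mono : {G H : Graph n} → G ⊆ H → ∀ {x y} → Connected G x y → Connected H x y
connected-mono G⊆H = Star.map G⊆H

Isolated : Graph n → Fin n → Set
Isolated G v = ∀ {y} → ¬ Edge G v y

isolated⇒¬connected : {G : Graph n} {v w : Fin n} → Isolated G v → v ≢ w → ¬ Connected G v w
isolated⇒¬connected iso v≢w ε       = v≢w refl
isolated⇒¬connected iso v≢w (e ◅ _) = iso e

TwoNeighbours : Graph n → Fin n → Set
TwoNeighbours G v = ∃₂ λ x y → x ≢ y × Edge G v x × Edge G v y

Pendant : Graph n → Fin n → Fin n → Set
Pendant G v w = Edge G v w × (∀ y → Edge G v y → y ≡ w)

MaxDegreeOne : Graph n → Set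
MaxDegreeOne G = ∀ x → ¬ TwoNeighbours G x

neighbour-unique : {G : Graph n} → MaxDegreeOne G → ∀ {x y z} → Edge G x y → Edge G x z → y ≡ z
neighbour-unique maxOne {x} {y} {z} xy xz with y ≟ z
... | yes y≡z = y≡z
... | no y≢z  = contradiction (y , z , y≢z , xy , xz) (maxOne x)

matching-component : {G : Graph n} → MaxDegreeOne G →
                     ∀ {u v y} → Edge G u v → Connected G u y → y ≡ u ⊎ y ≡ v
matching-component maxOne uv ε = inj₁ refl
matching-component maxOne uv (ut ◅ t~y) with refl ← neighbour-unique maxOne uv ut =
  Sum.swap (matching-component maxOne (edge-sym uv) t~y)

edge? : (G : Graph n) → ∀ x y → Dec (Edge G x y)
edge? G x y = map′ edge isEdge (adj G x y Data.Bool.≟ true)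

twoNeighbours? : (G : Graph n) (w : Fin n) → Dec (TwoNeighbours G w)
twoNeighbours? G w = any?ᶠ λ x → any?ᶠ λ y → ¬? (x ≟ y) ×-dec edge? G w x ×-dec edge? G w y

sameDegSeq⇒count : {G H : Graph n} → SameDegSeq G H → ∀ v → count (adj G v) ≡ count (adj H v)
sameDegSeq⇒count {G = G} {H} same v = trans (sym (degree≡count G v)) (trans (same v) (degree≡count H v))

module _ {G H : Graph n} (same : SameDegSeq G H) where

  private
    sameCount : ∀ v → count (adj G v) ≡ count (adj H v)
    sameCount = sameDegSeq⇒count {G = G} {H} same

  edge-transfer : ∀ {v w} → Edge G v w → ∃ (Edge H v)
  edge-transfer {v} (edge e)
    with w , e′ ← 1≤count⇒true (subst (1 ≤_) (sameCount v) (true⇒1≤count (adj G v) e)) = w , edge e′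

  twoNeighbours-transfer : ∀ {v} → TwoNeighbours G v → TwoNeighbours H v
  twoNeighbours-transfer {v} (x , y , x≢y , edge vx , edge vy)
    with x′ , y′ , x′≢y′ , vx′ , vy′ ←
         2≤count⇒twoTrue (subst (2 ≤_) (sameCount v) (twoTrue⇒2≤count (adj G v) x≢y vx vy)) =
    x′ , y′ , x′≢y′ , edge vx′ , edge vy′

  pendant-transfer : ∀ {v w u} → Pendant G v w → Edge H v u → Pendant H v u
  pendant-transfer {v} (edge vw , onlyW) vu
    with i , _ , onlyI ← count≡1⇒uniqueTrue
           (trans (sym (sameCount v)) (uniqueTrue⇒count≡1 (adj G v) vw (λ y → onlyW y ∘ edge))) =
    vu , λ y vy → trans (onlyI y (isEdge vy)) (sym (onlyI _ (isEdge vu)))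

deleteEdge : Graph n → Fin n → Fin n → Graph n
deleteEdge G u v = record
  { adj    = λ x y → adj G x y ∧ not (samePair x y u v)
  ; sym    = λ x y → cong₂ (λ a s → a ∧ not s) (Graph.sym G x y) (samePair-sym x y u v)
  ; irrefl = λ x → cong (_∧ _) (Graph.irrefl G x)
  }

addEdge : (G : Graph n) (u v : Fin n) → u ≢ v → Graph n
addEdge G u v u≢v = record
  { adj    = λ x y → adj G x y ∨ samePair x y u v
  ; sym    = λ x y → cong₂ _∨_ (Graph.sym G x y) (samePair-sym x y u v)
  ; irrefl = λ x → cong₂ _∨_ (Graph.irrefl G x) (samePair-false (¬samePair-loop {x = x} u≢v))
  }

module _ {G : Graph n} {u v : Fin n} where

  deleteEdge⁻ : ∀ {x y} → Edge (deleteEdge G u v) x y → Edge G x y × ¬ SamePair x y u v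
  deleteEdge⁻ {x} {y} (edge e) =
    edge (∧-conicalˡ (adj G x y) _ e) ,
    λ xy≐uv → case trans (sym (∧-conicalʳ (adj G x y) _ e)) (cong not (samePair-true xy≐uv)) of λ ()

  deleteEdge-⊆ : deleteEdge G u v ⊆ G
  deleteEdge-⊆ = proj₁ ∘ deleteEdge⁻

  deleteEdge⁺ : ∀ {x y} → Edge G x y → ¬ SamePair x y u v → Edge (deleteEdge G u v) x y
  deleteEdge⁺ (edge e) ¬s = edge (cong₂ (λ a s → a ∧ not s) e (samePair-false ¬s))

module _ {G : Graph n} {u v : Fin n} (u≢v : u ≢ v) where

  addEdge⁻ : ∀ {x y} → Edge (addEdge G u v u≢v) x y → Edge G x y ⊎ SamePair x y u v
  addEdge⁻ {x} {y} (edge e) with adj G x y in g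
  ... | true  = inj₁ (edge g)
  ... | false = inj₂ (samePair-sound e)

  addEdge-⊆ : G ⊆ addEdge G u v u≢v
  addEdge-⊆ (edge e) = edge (cong (_∨ _) e)

  addEdge⁺ : ∀ {x y} → SamePair x y u v → Edge (addEdge G u v u≢v) x y
  addEdge⁺ {x} {y} s = edge (trans (cong (adj G x y ∨_) (samePair-true s)) (∨-zeroʳ (adj G x y)))

deleteEdge-mono : {G H : Graph n} {u v : Fin n} → G ⊆ H → deleteEdge G u v ⊆ deleteEdge H u v
deleteEdge-mono G⊆H e with g , ¬s ← deleteEdge⁻ e = deleteEdge⁺ (G⊆H g) ¬s

addEdge-deleteEdge : {G : Graph n} {v w : Fin n} (v≢w : v ≢ w) → Edge G v w →
                     SameGraph G (addEdge (deleteEdge G v w) v w v≢w)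
addEdge-deleteEdge {G = G} {v} {w} v≢w vw x y =
  restore (adj G x y) (samePair x y v w) (isEdge ∘ onPair ∘ samePair-sound)
  where
  restore : ∀ g s → (s ≡ true → g ≡ true) → g ≡ (g ∧ not s) ∨ s
  restore g false _ = sym (trans (∨-identityʳ _) (∧-identityʳ g))
  restore g true  h = trans (h refl) (sym (∨-zeroʳ _))
  onPair : SamePair x y v w → Edge G x y
  onPair (inj₁ (refl , refl)) = vw
  onPair (inj₂ (refl , refl)) = edge-sym vw

pendant⇒isolated : {G : Graph n} {v w : Fin n} → Pendant G v w → Isolated (deleteEdge G v w) v
pendant⇒isolated (_ , onlyW) e with vy , ¬vy≐vw ← deleteEdge⁻ e = ¬vy≐vw (inj₁ (refl , onlyW _ vy))

module _ {G : Graph n} {v w : Fin n} where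

  count-deleteEdge-end : ∀ {x y} → Edge G x y → SamePair x y v w →
                         count (adj G x) ≡ suc (count (adj (deleteEdge G v w) x))
  count-deleteEdge-end {x} {y} (edge xy) xy≐vw = count-remove y xy removed kept
    where
    removed : adj G x y ∧ not (samePair x y v w) ≡ false
    removed = trans (cong (λ s → adj G x y ∧ not s) (samePair-true xy≐vw)) (∧-zeroʳ _)
    kept : ∀ z → z ≢ y → adj G x z ≡ adj G x z ∧ not (samePair x z v w)
    kept z z≢y = sym (trans (cong (λ s → adj G x z ∧ not s) (samePair-false (z≢y ∘ samePair-other xy≐vw)))
                            (∧-identityʳ _))

  count-deleteEdge-away : ∀ {x} → x ≢ v → x ≢ w → count (adj G x) ≡ count (adj (deleteEdge G v w) x)
  count-deleteEdge-away {x} x≢v x≢w = count-cong λ z →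
    sym (trans (cong (λ s → adj G x z ∧ not s) (samePair-false (¬samePairˡ {y = z} x≢v x≢w)))
               (∧-identityʳ _))

deleteEdge-sameDegSeq : {G H : Graph n} {v w : Fin n} → Edge G v w → Edge H v w → SameDegSeq G H →
                        SameDegSeq (deleteEdge G v w) (deleteEdge H v w)
deleteEdge-sameDegSeq {G = G} {H} {v} {w} vwG vwH same x =
  trans (degree≡count (deleteEdge G v w) x)
        (trans (byCases (x ≟ v) (x ≟ w)) (sym (degree≡count (deleteEdge H v w) x)))
  where
  sameCount : count (adj G x) ≡ count (adj H x)
  sameCount = sameDegSeq⇒count {G = G} {H} same x
  byCases : Dec (x ≡ v) → Dec (x ≡ w) → count (adj (deleteEdge G v w) x) ≡ count (adj (deleteEdge H v w) x)
  byCases (yes refl) _ = ℕ.suc-injective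
    (trans (sym (count-deleteEdge-end vwG (inj₁ (refl , refl))))
           (trans sameCount (count-deleteEdge-end vwH (inj₁ (refl , refl)))))
  byCases (no _) (yes refl) = ℕ.suc-injective
    (trans (sym (count-deleteEdge-end (edge-sym vwG) (inj₂ (refl , refl))))
           (trans sameCount (count-deleteEdge-end (edge-sym vwH) (inj₂ (refl , refl)))))
  byCases (no x≢v) (no x≢w) =
    trans (sym (count-deleteEdge-away {G = G} x≢v x≢w))
          (trans sameCount (count-deleteEdge-away {G = H} x≢v x≢w))

connected-addEdge⁻ : {G : Graph n} {u v : Fin n} (u≢v : u ≢ v) {x y : Fin n} →
                     Connected (addEdge G u v u≢v) x y →
                     Connected G x y ⊎ (Connected G x u × Connected G v y) ⊎ (Connected G x v × Connected G u y)
connected-addEdge⁻ _ ε = inj₁ ε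
connected-addEdge⁻ {G = G} {u} {v} u≢v {x} {y} (_◅_ {j = z} e rest) =
  extend (addEdge⁻ u≢v e) (connected-addEdge⁻ u≢v rest)
  where
  extend : Edge G x z ⊎ SamePair x z u v →
           Connected G z y ⊎ (Connected G z u × Connected G v y) ⊎ (Connected G z v × Connected G u y) →
           Connected G x y ⊎ (Connected G x u × Connected G v y) ⊎ (Connected G x v × Connected G u y)
  extend (inj₁ xz) (inj₁ zy)                = inj₁ (xz ◅ zy)
  extend (inj₁ xz) (inj₂ (inj₁ (zu , vy)))  = inj₂ (inj₁ (xz ◅ zu , vy))
  extend (inj₁ xz) (inj₂ (inj₂ (zv , uy)))  = inj₂ (inj₂ (xz ◅ zv , uy))
  extend (inj₂ (inj₁ (refl , refl))) (inj₁ vy)              = inj₂ (inj₁ (ε , vy))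
  extend (inj₂ (inj₁ (refl , refl))) (inj₂ (inj₁ (_ , vy))) = inj₂ (inj₁ (ε , vy))
  extend (inj₂ (inj₁ (refl , refl))) (inj₂ (inj₂ (_ , uy))) = inj₁ uy
  extend (inj₂ (inj₂ (refl , refl))) (inj₁ uy)              = inj₂ (inj₂ (ε , uy))
  extend (inj₂ (inj₂ (refl , refl))) (inj₂ (inj₁ (_ , vy))) = inj₁ vy
  extend (inj₂ (inj₂ (refl , refl))) (inj₂ (inj₂ (_ , uy))) = inj₂ (inj₂ (ε , uy))

-- Forests

EdgesAreBridges : Graph n → Set
EdgesAreBridges G = ∀ {u v} → Edge G u v → ¬ Connected (deleteEdge G u v) u v

edgesAreBridges-⊆ : {G H : Graph n} → H ⊆ G → EdgesAreBridges G → EdgesAreBridges H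
edgesAreBridges-⊆ H⊆G bridges e c = bridges (H⊆G e) (connected-mono (deleteEdge-mono H⊆G) c)

module _ {G : Graph n} {u v : Fin n} (u≢v : u ≢ v) {x y : Fin n} where

  deleteEdge-addEdge-⊆ : deleteEdge (addEdge G u v u≢v) x y ⊆ addEdge (deleteEdge G x y) u v u≢v
  deleteEdge-addEdge-⊆ e with e′ , ¬ab≐xy ← deleteEdge⁻ e with addEdge⁻ u≢v e′
  ... | inj₁ g     = addEdge-⊆ u≢v (deleteEdge⁺ g ¬ab≐xy)
  ... | inj₂ ab≐uv = addEdge⁺ u≢v ab≐uv

  deleteEdge-addEdge-same-⊆ : SamePair x y u v → deleteEdge (addEdge G u v u≢v) x y ⊆ G
  deleteEdge-addEdge-same-⊆ xy≐uv e with e′ , ¬ab≐xy ← deleteEdge⁻ e with addEdge⁻ u≢v e′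
  ... | inj₁ g     = g
  ... | inj₂ ab≐uv = contradiction (samePair-trans ab≐uv xy≐uv) ¬ab≐xy

edgesAreBridges-addEdge : {G : Graph n} {u v : Fin n} (u≢v : u ≢ v) →
                          EdgesAreBridges G → ¬ Connected G u v → EdgesAreBridges (addEdge G u v u≢v)
edgesAreBridges-addEdge {G = G} {u} {v} u≢v bridges ¬u~v {x} {y} e c with addEdge⁻ u≢v e
... | inj₂ xy≐uv = ¬u~v (ends xy≐uv (connected-mono (deleteEdge-addEdge-same-⊆ u≢v xy≐uv) c))
  where
  ends : SamePair x y u v → Connected G x y → Connected G u v
  ends (inj₁ (refl , refl)) = id
  ends (inj₂ (refl , refl)) = connected-sym
... | inj₁ xy with connected-addEdge⁻ u≢v (connected-mono (deleteEdge-addEdge-⊆ u≢v) c)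
...   | inj₁ x~y                = bridges xy x~y
...   | inj₂ (inj₁ (x~u , v~y)) =
  ¬u~v (connected-sym (connected-mono deleteEdge-⊆ x~u) ◅◅ xy ◅ connected-sym (connected-mono deleteEdge-⊆ v~y))
...   | inj₂ (inj₂ (x~v , u~y)) =
  ¬u~v (connected-mono deleteEdge-⊆ u~y ◅◅ edge-sym xy ◅ connected-mono deleteEdge-⊆ x~v)

data Chain (G : Graph n) : Fin n → Fin n → List (Fin n) → Set where
  [_] : ∀ x → Chain G x x (x ∷ [])
  _∷_ : ∀ {x y z vs} → Edge G x y → Chain G y z vs → Chain G x z (x ∷ vs)

module _ {G : Graph n} where

  chain⇒walk : ∀ {x z vs} → Chain G x z vs → Walk G vs
  chain⇒walk [ x ]               = single x
  chain⇒walk (edge e ∷ [ z ])    = step _ _ _ e (single z)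
  chain⇒walk (edge e ∷ (f ∷ ch)) = step _ _ _ e (chain⇒walk (f ∷ ch))

  chain-last : ∀ {x z vs} → Chain G x z vs → ∃ λ init → vs ≡ init ++ z ∷ []
  chain-last [ x ]                 = [] , refl
  chain-last (_∷_ {x = x} _ ch) with init , refl ← chain-last ch = x ∷ init , refl

  chain-suffix : ∀ {x y z vs} → Chain G y z vs → x ∈ vs →
                 ∃ λ ws → Chain G x z ws × (AllPairs _≢_ vs → AllPairs _≢_ ws)
  chain-suffix ch@([ _ ]) (here refl) = _ , ch , id
  chain-suffix ch@(_ ∷ _) (here refl) = _ , ch , id
  chain-suffix (_ ∷ ch)   (there x∈vs) with ws , ch′ , distinct ← chain-suffix ch x∈vs =
    ws , ch′ , λ { (_ ∷ d) → distinct d }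

  connected⇒simpleChain : ∀ {x z} → Connected G x z → ∃ λ vs → Chain G x z vs × AllPairs _≢_ vs
  connected⇒simpleChain {x} ε = _ , [ x ] , [] ∷ []
  connected⇒simpleChain {x} (e ◅ c) with vs , ch , distinct ← connected⇒simpleChain c with any? (x ≟_) vs
  ... | yes x∈vs = let ws , ch′ , suffix = chain-suffix ch x∈vs in ws , ch′ , suffix distinct
  ... | no  x∉vs = x ∷ vs , e ∷ ch , ¬Any⇒All¬ vs x∉vs ∷ distinct

chain-mono : {G H : Graph n} → G ⊆ H → ∀ {x z vs} → Chain G x z vs → Chain H x z vs
chain-mono G⊆H [ x ]    = [ x ]
chain-mono G⊆H (e ∷ ch) = G⊆H e ∷ chain-mono G⊆H ch

isForest⇒edgesAreBridges : {G : Graph n} → IsForest G → EdgesAreBridges G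
isForest⇒edgesAreBridges forest uv c with connected⇒simpleChain c
... | _ , [ _ ] , _          = edge⇒≢ uv refl
... | _ , e ∷ [ _ ] , _      = proj₂ (deleteEdge⁻ e) (inj₁ (refl , refl))
... | _ , e ∷ (f ∷ ch) , distinct with init , refl ← chain-last ch =
  forest (_ , _ ∷ init , _ , s≤s (1≤length-∷ʳ init) , distinct ,
          chain⇒walk (chain-mono deleteEdge-⊆ (e ∷ f ∷ ch)) , isEdge (edge-sym uv))

walk⇒connected : {G : Graph n} {p q x z : Fin n} (ys : List (Fin n)) → Walk G (x ∷ ys ++ z ∷ []) →
                 All (λ t → t ≢ p × t ≢ q) (x ∷ ys) → Connected (deleteEdge G p q) x z
walk⇒connected []       (step _ _ _ e _) ((x≢p , x≢q) ∷ []) =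
  deleteEdge⁺ (edge e) (¬samePairˡ x≢p x≢q) ◅ ε
walk⇒connected (y ∷ ys) (step _ _ _ e w) ((x≢p , x≢q) ∷ avoid) =
  deleteEdge⁺ (edge e) (¬samePairˡ x≢p x≢q) ◅ walk⇒connected ys w avoid

edgesAreBridges⇒isForest : {G : Graph n} → EdgesAreBridges G → IsForest G
edgesAreBridges⇒isForest bridges (_ , [] , _ , s≤s () , _)
edgesAreBridges⇒isForest bridges
  (v₀ , r ∷ rs , vk , _ , (v₀≢ ∷ r≢ ∷ distinct) , step _ _ _ v₀r walk , closing) =
  bridges (edge closing) (connected-sym (deleteEdge⁺ (edge v₀r) first-avoids ◅ walk⇒connected rs walk avoid))
  where
  v₀≢vk : v₀ ≢ vk
  v₀≢vk with v₀≢vk ∷ [] ← ++⁻ʳ (r ∷ rs) v₀≢ = v₀≢vk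
  r≢vk : r ≢ vk
  r≢vk with r≢vk ∷ [] ← ++⁻ʳ rs r≢ = r≢vk
  first-avoids : ¬ SamePair v₀ r vk v₀
  first-avoids (inj₁ (v₀≡vk , _)) = v₀≢vk v₀≡vk
  first-avoids (inj₂ (_ , r≡vk))  = r≢vk r≡vk
  avoid : All (λ t → t ≢ vk × t ≢ v₀) (r ∷ rs)
  avoid = All.zip (distinct-last (r ∷ rs) (r≢ ∷ distinct) , All.map ≢-sym (++⁻ˡ (r ∷ rs) v₀≢))

walk-mono : {G H : Graph n} → G ⊆ H → ∀ {vs} → Walk G vs → Walk H vs
walk-mono G⊆H (single v)        = single v
walk-mono G⊆H (step u v vs e w) = step u v vs (isEdge (G⊆H (edge e))) (walk-mono G⊆H w)

isForest-⊆ : {G H : Graph n} → H ⊆ G → IsForest G → IsForest H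
isForest-⊆ H⊆G forest (v₀ , rest , vk , len , distinct , walk , closing) =
  forest (v₀ , rest , vk , len , distinct , walk-mono H⊆G walk , isEdge (H⊆G (edge closing)))

isForest-addEdge : {G : Graph n} {u v : Fin n} (u≢v : u ≢ v) → IsForest G → ¬ Connected G u v →
                   IsForest (addEdge G u v u≢v)
isForest-addEdge u≢v forest ¬u~v =
  edgesAreBridges⇒isForest (edgesAreBridges-addEdge u≢v (isForest⇒edgesAreBridges forest) ¬u~v)

walk-prefix : {G : Graph n} (x : Fin n) (xs : List (Fin n)) {ys : List (Fin n)} →
              Walk G (x ∷ xs ++ ys) → Walk G (x ∷ xs)
walk-prefix x []        _                = single x
walk-prefix x (x′ ∷ xs) (step _ _ _ e w) = step x x′ xs e (walk-prefix x′ xs w)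

WithinSteps : Graph n → ℕ → Fin n → Fin n → Set
WithinSteps G zero    x z = x ≡ z
WithinSteps G (suc k) x z = WithinSteps G k x z ⊎ ∃ λ y → Edge G x y × WithinSteps G k y z

module _ (G : Graph n) where

  withinSteps? : ∀ k x z → Dec (WithinSteps G k x z)
  withinSteps? zero    x z = x ≟ z
  withinSteps? (suc k) x z = withinSteps? k x z ⊎-dec any?ᶠ (λ y → edge? G x y ×-dec withinSteps? k y z)

  withinSteps⇒connected : ∀ k {x z} → WithinSteps G k x z → Connected G x z
  withinSteps⇒connected zero    refl                 = ε
  withinSteps⇒connected (suc k) (inj₁ w)             = withinSteps⇒connected k w
  withinSteps⇒connected (suc k) (inj₂ (y , e , w))   = e ◅ withinSteps⇒connected k w

  withinSteps-refl : ∀ k x → WithinSteps G k x x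
  withinSteps-refl zero    x = refl
  withinSteps-refl (suc k) x = inj₁ (withinSteps-refl k x)

  chain⇒withinSteps : ∀ k {x z vs} → Chain G x z vs → length vs ≤ suc k → WithinSteps G k x z
  chain⇒withinSteps k       [ x ]          _         = withinSteps-refl k x
  chain⇒withinSteps zero    (_ ∷ [ _ ])    (s≤s ())
  chain⇒withinSteps zero    (_ ∷ (_ ∷ _))  (s≤s ())
  chain⇒withinSteps (suc k) (e ∷ ch)       (s≤s len) = inj₂ (_ , e , chain⇒withinSteps k ch len)

  connected? : ∀ x z → Dec (Connected G x z)
  connected? x z = map′ (withinSteps⇒connected n) shortChain (withinSteps? n x z)
    where
    shortChain : Connected G x z → WithinSteps G n x z
    shortChain c with _ , ch , distinct ← connected⇒simpleChain c =
      chain⇒withinSteps n ch (ℕ.≤-trans (distinct⇒length≤ distinct) (ℕ.n≤1+n n))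

-- Leaves

-- The path e p q … is extended at e while e has a neighbour other than p; acyclicity makes
-- the new neighbour fresh, so after at most n steps e is a leaf whose neighbour p also sees q.
extendToLeaf : {G : Graph n} → IsForest G → (k : ℕ) (e p q : Fin n) (rest : List (Fin n)) →
               n < k + length (e ∷ p ∷ q ∷ rest) →
               AllPairs _≢_ (e ∷ p ∷ q ∷ rest) → Walk G (e ∷ p ∷ q ∷ rest) →
               ∃₂ λ v w → Pendant G v w × TwoNeighbours G w
extendToLeaf {n} {G} forest k e p q rest bound
             distinct@((_ ∷ e≢q ∷ _) ∷ _) walk@(step _ _ _ ep (step _ _ _ pq _))
  with any?ᶠ (λ z → edge? G e z ×-dec ¬? (z ≟ p))
... | no noOther = e , p , (edge ep , onlyP) , e , q , e≢q , edge-sym (edge ep) , edge pq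
  where
  onlyP : ∀ y → Edge G e y → y ≡ p
  onlyP y ey with y ≟ p
  ... | yes y≡p = y≡p
  ... | no y≢p  = contradiction (y , ey , y≢p) noOther
... | yes (z , ez , z≢p) with any? (z ≟_) (e ∷ p ∷ q ∷ rest)
...   | yes (here z≡e)         = contradiction (sym z≡e) (edge⇒≢ ez)
...   | yes (there (here z≡p)) = contradiction z≡p z≢p
...   | yes (there (there z∈)) with ys , zs , q∷rest≡ ← ∈-∃++ z∈ =
  ⊥-elim (forest (e , p ∷ ys , z , s≤s (1≤length-∷ʳ ys) ,
                  allPairs-prefix (e ∷ p ∷ ys ++ z ∷ []) (subst (AllPairs _≢_) path≡ distinct) ,
                  walk-prefix e (p ∷ ys ++ z ∷ []) (subst (Walk G) path≡ walk) , isEdge (edge-sym ez)))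
  where
  path≡ : e ∷ p ∷ q ∷ rest ≡ (e ∷ p ∷ ys ++ z ∷ []) ++ zs
  path≡ = cong (λ t → e ∷ p ∷ t) (trans q∷rest≡ (sym (++-assoc ys (z ∷ []) zs)))
...   | no z∉ with k
...     | zero  = contradiction (distinct⇒length≤ distinct) (ℕ.<⇒≱ bound)
...     | suc k = extendToLeaf forest k z e p (q ∷ rest) (subst (n <_) (sym (ℕ.+-suc k _)) bound)
                               (¬Any⇒All¬ _ z∉ ∷ distinct) (step z e _ (isEdge (edge-sym ez)) walk)

findLeaf : {G : Graph n} → IsForest G → ∀ {x y} → Edge G x y →
           ∃₂ λ v w → Pendant G v w × (TwoNeighbours G w ⊎ MaxDegreeOne G)
findLeaf {n} {G} forest {x} {y} xy with any?ᶠ (twoNeighbours? G)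
... | yes (w , z₁ , z₂ , z₁≢z₂ , wz₁ , wz₂)
  with v , w′ , pendant , two ← extendToLeaf forest n z₁ w z₂ [] (ℕ.m<m+n n (s≤s z≤n))
         ((edge⇒≢ (edge-sym wz₁) ∷ z₁≢z₂ ∷ []) ∷ (edge⇒≢ wz₂ ∷ []) ∷ [] ∷ [])
         (step z₁ w _ (isEdge (edge-sym wz₁)) (step w z₂ [] (isEdge wz₂) (single z₂)))
  = v , w′ , pendant , inj₁ two
... | no none = x , y , (xy , λ y′ xy′ → neighbour-unique maxOne xy′ xy) , inj₂ maxOne
  where
  maxOne : MaxDegreeOne G
  maxOne w two = none (w , two)

-- 2-switches

record Distinct₄ (a b c d : Fin n) : Set where
  field
    a≢b : a ≢ b
    a≢c : a ≢ c
    a≢d : a ≢ d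
    b≢c : b ≢ c
    b≢d : b ≢ d
    c≢d : c ≢ d

-- switchedAdj G a b c d x y unfolds to switchBool applied to the four pair tests and adj G x y.
switchBool : Bool → Bool → Bool → Bool → Bool → Bool
switchBool removed₁ removed₂ added₁ added₂ g =
  if removed₁ ∨ removed₂ then false else if added₁ ∨ added₂ then true else g

switchBool-true⁻ : ∀ r₁ r₂ a₁ a₂ g → switchBool r₁ r₂ a₁ a₂ g ≡ true →
                   r₁ ≡ false × r₂ ≡ false × (g ≡ true ⊎ a₁ ≡ true ⊎ a₂ ≡ true)
switchBool-true⁻ false false true  _     _    _ = refl , refl , inj₂ (inj₁ refl)
switchBool-true⁻ false false false true  _    _ = refl , refl , inj₂ (inj₂ refl)
switchBool-true⁻ false false false false true _ = refl , refl , inj₁ refl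

switchBool-∨ : ∀ r₁ r₂ a₁ a₂ g t →
               (t ≡ true → r₁ ≡ false × r₂ ≡ false × a₁ ≡ false × a₂ ≡ false) →
               switchBool r₁ r₂ a₁ a₂ g ∨ t ≡ switchBool r₁ r₂ a₁ a₂ (g ∨ t)
switchBool-∨ r₁ r₂ a₁ a₂ g false _ =
  trans (∨-identityʳ _) (cong (switchBool r₁ r₂ a₁ a₂) (sym (∨-identityʳ g)))
switchBool-∨ r₁ r₂ a₁ a₂ g true  h with refl , refl , refl , refl ← h refl = refl

module _ (G : Graph n) (a b c d : Fin n) where

  switchedAdj-flip : ∀ x y → switchedAdj G a b c d x y ≡ switchedAdj G b a d c x y
  switchedAdj-flip x y =
    cong₂ (λ r s → if r then false else if s then true else adj G x y)
          (cong₂ _∨_ (samePair-swap x y a b) (samePair-swap x y c d)) (∨-comm (samePair x y a c) _)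

  switchedAdj-rotate : ∀ x y → switchedAdj G a b c d x y ≡ switchedAdj G c d a b x y
  switchedAdj-rotate x y =
    cong₂ (λ r s → if r then false else if s then true else adj G x y)
          (∨-comm (samePair x y a b) _) (cong₂ _∨_ (samePair-swap x y a c) (samePair-swap x y b d))

  switchedAdj-removed : ∀ x y → SamePair x y a b → switchedAdj G a b c d x y ≡ false
  switchedAdj-removed x y xy≐ab =
    cong (λ r → switchBool r (samePair x y c d) (samePair x y a c) (samePair x y b d) (adj G x y))
         (samePair-true xy≐ab)

  switchedAdj-added : ∀ x y → ¬ SamePair x y a b → ¬ SamePair x y c d → SamePair x y a c →
                      switchedAdj G a b c d x y ≡ true
  switchedAdj-added x y ¬ab ¬cd xy≐ac =
    cong₂ (λ (r₁ , r₂) a₁ → switchBool r₁ r₂ a₁ (samePair x y b d) (adj G x y))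
          (cong₂ _,_ (samePair-false ¬ab) (samePair-false ¬cd)) (samePair-true xy≐ac)

  switchedAdj-kept : ∀ x y → ¬ SamePair x y a b → ¬ SamePair x y c d →
                     ¬ SamePair x y a c → ¬ SamePair x y b d → switchedAdj G a b c d x y ≡ adj G x y
  switchedAdj-kept x y ¬ab ¬cd ¬ac ¬bd =
    cong₂ (λ (r₁ , r₂) (a₁ , a₂) → switchBool r₁ r₂ a₁ a₂ (adj G x y))
          (cong₂ _,_ (samePair-false ¬ab) (samePair-false ¬cd))
          (cong₂ _,_ (samePair-false ¬ac) (samePair-false ¬bd))

  switchedAdj-away : ∀ {x} → x ≢ a → x ≢ b → x ≢ c → x ≢ d →
                     ∀ y → switchedAdj G a b c d x y ≡ adj G x y
  switchedAdj-away x≢a x≢b x≢c x≢d y =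
    switchedAdj-kept _ y (¬samePairˡ x≢a x≢b) (¬samePairˡ x≢c x≢d)
                         (¬samePairˡ x≢a x≢c) (¬samePairˡ x≢b x≢d)

  count-switchedAdj-row : a ≢ b → a ≢ c → a ≢ d → b ≢ c → Edge G a b → adj G a c ≡ false →
                          count (switchedAdj G a b c d a) ≡ count (adj G a)
  count-switchedAdj-row a≢b a≢c a≢d b≢c (edge ab) ac = sym (count-swap b c b≢c ab ac removed added kept)
    where
    removed : switchedAdj G a b c d a b ≡ false
    removed = switchedAdj-removed a b (inj₁ (refl , refl))
    added : switchedAdj G a b c d a c ≡ true
    added = switchedAdj-added a c (¬samePairʳ (≢-sym a≢c) (≢-sym b≢c)) (¬samePairˡ a≢c a≢d)
                                  (inj₁ (refl , refl))
    kept : ∀ y → y ≢ b → y ≢ c → adj G a y ≡ switchedAdj G a b c d a y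
    kept y y≢b y≢c = sym (switchedAdj-kept a y
      (λ { (inj₁ (_ , y≡b)) → y≢b y≡b ; (inj₂ (a≡b , _)) → a≢b a≡b })
      (¬samePairˡ a≢c a≢d)
      (λ { (inj₁ (_ , y≡c)) → y≢c y≡c ; (inj₂ (a≡c , _)) → a≢c a≡c })
      (¬samePairˡ a≢b a≢d))

switch : (G : Graph n) (a b c d : Fin n) → Distinct₄ a b c d → Graph n
switch G a b c d D = record
  { adj    = switchedAdj G a b c d
  ; sym    = λ x y → cong₂ (λ (r₁ , r₂) (a₁ , a₂ , g) → switchBool r₁ r₂ a₁ a₂ g)
                       (cong₂ _,_ (samePair-sym x y a b) (samePair-sym x y c d))
                       (cong₂ _,_ (samePair-sym x y a c) (cong₂ _,_ (samePair-sym x y b d) (Graph.sym G x y)))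
  ; irrefl = λ x → trans (switchedAdj-kept G a b c d x x (¬samePair-loop a≢b) (¬samePair-loop c≢d)
                                                          (¬samePair-loop a≢c) (¬samePair-loop b≢d))
                         (Graph.irrefl G x)
  }
  where open Distinct₄ D

module _ {G : Graph n} {a b c d : Fin n} (D : Distinct₄ a b c d) where
  open Distinct₄ D

  -- The switch is unchanged under (a b c d) ↦ (b a d c) and (c d a b), so the row count at a
  -- also settles b, c and d.
  switch-sameDegSeq : Edge G a b → Edge G c d → adj G a c ≡ false → adj G b d ≡ false →
                      SameDegSeq (switch G a b c d D) G
  switch-sameDegSeq ab cd ac bd x =
    trans (degree≡count (switch G a b c d D) x) (trans (rowCount x) (sym (degree≡count G x)))
    where
    ca : adj G c a ≡ false
    ca = trans (Graph.sym G c a) ac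
    db : adj G d b ≡ false
    db = trans (Graph.sym G d b) bd
    rowCount : ∀ x → count (switchedAdj G a b c d x) ≡ count (adj G x)
    rowCount x = byCases x (x ≟ a) (x ≟ b) (x ≟ c) (x ≟ d)
      where
      byCases : ∀ x → Dec (x ≡ a) → Dec (x ≡ b) → Dec (x ≡ c) → Dec (x ≡ d) →
                count (switchedAdj G a b c d x) ≡ count (adj G x)
      byCases _ (yes refl) _ _ _ = count-switchedAdj-row G a b c d a≢b a≢c a≢d b≢c ab ac
      byCases _ (no _) (yes refl) _ _ =
        trans (count-cong (switchedAdj-flip G a b c d b))
              (count-switchedAdj-row G b a d c (≢-sym a≢b) b≢d b≢c a≢d (edge-sym ab) bd)
      byCases _ (no _) (no _) (yes refl) _ =
        trans (count-cong (switchedAdj-rotate G a b c d c))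
              (count-switchedAdj-row G c d a b c≢d (≢-sym a≢c) (≢-sym b≢c) (≢-sym a≢d) cd ca)
      byCases _ (no _) (no _) (no _) (yes refl) =
        trans (count-cong (λ y → trans (switchedAdj-rotate G a b c d d y) (switchedAdj-flip G c d a b d y)))
              (count-switchedAdj-row G d c b a (≢-sym c≢d) (≢-sym b≢d) (≢-sym a≢d) (≢-sym b≢c)
                                     (edge-sym cd) db)
      byCases x (no x≢a) (no x≢b) (no x≢c) (no x≢d) =
        count-cong (switchedAdj-away G a b c d x≢a x≢b x≢c x≢d)

  distinct₄ : AllPairs _≢_ (a ∷ b ∷ c ∷ d ∷ [])
  distinct₄ = (a≢b ∷ a≢c ∷ a≢d ∷ []) ∷ (b≢c ∷ b≢d ∷ []) ∷ (c≢d ∷ []) ∷ [] ∷ []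

  switch-⊆ : switch G a b c d D ⊆ addEdge (addEdge (deleteEdge (deleteEdge G a b) c d) a c a≢c) b d b≢d
  switch-⊆ {x} {y} (edge e)
    with switchBool-true⁻ (samePair x y a b) (samePair x y c d) (samePair x y a c) (samePair x y b d) (adj G x y) e
  ... | ¬ab , ¬cd , inj₁ g =
    addEdge-⊆ b≢d (addEdge-⊆ a≢c
      (deleteEdge⁺ (deleteEdge⁺ (edge g) (samePair-false⁻ ¬ab)) (samePair-false⁻ ¬cd)))
  ... | _ , _ , inj₂ (inj₁ ac) = addEdge-⊆ b≢d (addEdge⁺ a≢c (samePair-sound ac))
  ... | _ , _ , inj₂ (inj₂ bd) = addEdge⁺ b≢d (samePair-sound bd)

  switch-edgesAreBridges : EdgesAreBridges G → Edge G a b → Edge G c d →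
                           ¬ Connected (deleteEdge G a b) a c → ¬ Connected (deleteEdge G c d) b d →
                           EdgesAreBridges (switch G a b c d D)
  switch-edgesAreBridges bridges ab cd ¬a~c ¬b~d =
    edgesAreBridges-⊆ switch-⊆ (edgesAreBridges-addEdge b≢d K+ac-bridges ¬b~d′)
    where
    K : Graph _
    K = deleteEdge (deleteEdge G a b) c d
    K⊆G-ab : K ⊆ deleteEdge G a b
    K⊆G-ab = deleteEdge-⊆
    K⊆G-cd : K ⊆ deleteEdge G c d
    K⊆G-cd e with e′ , ¬cd ← deleteEdge⁻ e = deleteEdge⁺ (deleteEdge-⊆ e′) ¬cd
    K+ac-bridges : EdgesAreBridges (addEdge K a c a≢c)
    K+ac-bridges = edgesAreBridges-addEdge a≢c (edgesAreBridges-⊆ (deleteEdge-⊆ ∘ K⊆G-ab) bridges)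
                                                (¬a~c ∘ connected-mono K⊆G-ab)
    dc : Edge (deleteEdge G a b) d c
    dc = deleteEdge⁺ (edge-sym cd) (¬samePairˡ (≢-sym a≢d) (≢-sym b≢d))
    ¬b~d′ : ¬ Connected (addEdge K a c a≢c) b d
    ¬b~d′ b~d with connected-addEdge⁻ a≢c b~d
    ... | inj₁ b~d″              = ¬b~d (connected-mono K⊆G-cd b~d″)
    ... | inj₂ (inj₁ (b~a , _))  = bridges ab (connected-sym (connected-mono K⊆G-ab b~a))
    ... | inj₂ (inj₂ (_ , a~d))  = ¬a~c (connected-mono K⊆G-ab a~d ◅◅ dc ◅ ε)

  switch-forestSwitch : IsForest G → Edge G a b → Edge G c d →
                        ¬ Connected (deleteEdge G a b) a c → ¬ Connected (deleteEdge G c d) b d →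
                        ForestSwitch G (switch G a b c d D) × SameDegSeq (switch G a b c d D) G
  switch-forestSwitch forest ab cd ¬a~c ¬b~d =
    (forest ,
     edgesAreBridges⇒isForest (switch-edgesAreBridges (isForest⇒edgesAreBridges forest) ab cd ¬a~c ¬b~d) ,
     (a , b , c , d , distinct₄ , isEdge ab , isEdge cd , ¬-not ¬ac , ¬-not ¬bd , λ x y → refl)) ,
    switch-sameDegSeq ab cd (¬-not ¬ac) (¬-not ¬bd)
    where
    ¬ac : adj G a c ≢ true
    ¬ac e = ¬a~c (deleteEdge⁺ (edge e) (¬samePairʳ (≢-sym a≢c) (≢-sym b≢c)) ◅ ε)
    ¬bd : adj G b d ≢ true
    ¬bd e = ¬b~d (deleteEdge⁺ (edge e) (¬samePairˡ b≢c b≢d) ◅ ε)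

-- Along a path from u to x₂ avoiding wx₂ we never meet w (wx₂ is a bridge), so each vertex stays
-- joined to x₁ without wx₁; at x₂ the edge wx₂ then joins w to x₁ without wx₁.
approach-unique : {G : Graph n} → EdgesAreBridges G →
                  ∀ {u w x₁ x₂} → Edge G w x₁ → Edge G w x₂ → x₁ ≢ x₂ →
                  Connected (deleteEdge G w x₁) u x₁ → ¬ Connected (deleteEdge G w x₂) u x₂
approach-unique {G = G} bridges {w = w} {x₁} {x₂} wx₁ wx₂ x₁≢x₂ u~x₁ u~x₂ =
  bridges wx₁ (deleteEdge⁺ wx₂ wx₂-kept ◅ follow u~x₁ u~x₂)
  where
  wx₂-kept : ¬ SamePair w x₂ w x₁
  wx₂-kept (inj₁ (_ , x₂≡x₁)) = x₁≢x₂ (sym x₂≡x₁)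
  wx₂-kept (inj₂ (w≡x₁ , _))  = edge⇒≢ wx₁ w≡x₁
  follow : ∀ {t} → Connected (deleteEdge G w x₁) t x₁ → Connected (deleteEdge G w x₂) t x₂ →
           Connected (deleteEdge G w x₁) x₂ x₁
  follow t~x₁ ε = t~x₁
  follow {t} t~x₁ (_◅_ {j = t′} tt′ t′~x₂) with t′ ≟ w
  ... | yes refl = ⊥-elim (bridges wx₂ t′~x₂)
  ... | no t′≢w  = follow (deleteEdge⁺ (edge-sym (deleteEdge-⊆ tt′)) kept ◅ t~x₁) t′~x₂
    where
    kept : ¬ SamePair t′ t w x₁
    kept (inj₁ (t′≡w , _)) = t′≢w t′≡w
    kept (inj₂ (_ , refl)) = bridges wx₁ t~x₁

unreachableNeighbour : {F F′ : Graph n} → IsForest F → SameDegSeq F F′ → ∀ {u v w} →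
                       Edge F v u → Edge F′ v w → u ≢ w → TwoNeighbours F′ w ⊎ MaxDegreeOne F′ →
                       ∃ λ x → Edge F w x × ¬ Connected (deleteEdge F w x) u x
unreachableNeighbour {F = F} {F′} forest same {u} {w = w} vu vw′ u≢w (inj₁ two′)
  with x₁ , x₂ , x₁≢x₂ , wx₁ , wx₂ ← twoNeighbours-transfer {G = F′} {F} (sym ∘ same) two′
  with connected? (deleteEdge F w x₁) u x₁
... | no ¬u~x₁ = x₁ , wx₁ , ¬u~x₁
... | yes u~x₁ = x₂ , wx₂ , approach-unique (isForest⇒edgesAreBridges forest) wx₁ wx₂ x₁≢x₂ u~x₁
unreachableNeighbour {F = F} {F′} forest same {u} {w = w} vu vw′ u≢w (inj₂ maxOne′)
  with x , wx ← edge-transfer {G = F′} {F} (sym ∘ same) (edge-sym vw′) = x , wx , ¬u~x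
  where
  maxOne : MaxDegreeOne F
  maxOne y two = maxOne′ y (twoNeighbours-transfer {G = F} {F′} same two)
  ¬u~x : ¬ Connected (deleteEdge F w x) u x
  ¬u~x u~x with matching-component maxOne (edge-sym vu) (connected-mono deleteEdge-⊆ u~x)
  ... | inj₁ refl = edge⇒≢ vw′ (neighbour-unique maxOne (edge-sym vu) (edge-sym wx))
  ... | inj₂ refl = u≢w (neighbour-unique maxOne vu (edge-sym wx))

-- Switching vu, wx to vw, ux: v is isolated once vu is gone, and u, x are apart once wx is gone.
pendant-switch : {F : Graph n} → IsForest F → ∀ {u v w x} → Pendant F v u → Edge F w x →
                 v ≢ w → u ≢ w → ¬ Connected (deleteEdge F w x) u x →
                 ∃ λ F₁ → (ForestSwitch F F₁ × SameDegSeq F₁ F) × Edge F₁ v w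
pendant-switch {F = F} forest {u} {v} {w} {x} pendant wx v≢w u≢w ¬u~x
  = switch F v u w x D ,
    switch-forestSwitch D forest (proj₁ pendant) wx
                        (isolated⇒¬connected (pendant⇒isolated pendant) v≢w) ¬u~x ,
    edge (switchedAdj-added F v u w x v w vw≢vu (¬samePairˡ v≢w v≢x) (inj₁ (refl , refl)))
  where
  v≢x : v ≢ x
  v≢x refl = u≢w (sym (proj₂ pendant w (edge-sym wx)))
  D : Distinct₄ v u w x
  D = record { a≢b = edge⇒≢ (proj₁ pendant) ; a≢c = v≢w ; a≢d = v≢x
             ; b≢c = u≢w ; b≢d = λ { refl → ¬u~x ε } ; c≢d = edge⇒≢ wx }
  vw≢vu : ¬ SamePair v w v u
  vw≢vu (inj₁ (_ , w≡u))  = u≢w (sym w≡u)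
  vw≢vu (inj₂ (v≡u , _))  = edge⇒≢ (proj₁ pendant) v≡u

pendant-reachable : {F F′ : Graph n} {v w : Fin n} → IsForest F → SameDegSeq F F′ →
                    Pendant F′ v w → TwoNeighbours F′ w ⊎ MaxDegreeOne F′ →
                    ∃ λ F₁ → Star ForestSwitch F F₁ × SameDegSeq F₁ F′ × IsForest F₁ × Edge F₁ v w
pendant-reachable {F = F} {F′} {w = w} forest same pendant′ choice
  with u , vu ← edge-transfer {G = F′} {F} (sym ∘ same) (proj₁ pendant′)
  with u ≟ w
... | yes refl = F , ε , same , forest , vu
... | no u≢w
  with x , wx , ¬u~x ← unreachableNeighbour forest same vu (proj₁ pendant′) u≢w choice
  with F₁ , (switched@(_ , forest₁ , _) , sameDeg) , vw₁ ←
       pendant-switch forest (pendant-transfer {G = F′} {F} (sym ∘ same) pendant′ vu) wx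
                      (edge⇒≢ (proj₁ pendant′)) u≢w ¬u~x =
  F₁ , switched ◅ ε , (λ y → trans (sameDeg y) (same y)) , forest₁ , vw₁

-- Reattaching a pendant edge

module _ {v w : Fin n} (v≢w : v ≢ w) where

  -- The switch avoids v, so it commutes with adding the edge vw.
  forestSwitch-addEdge : {G H : Graph n} → Isolated G v → ForestSwitch G H →
                         ForestSwitch (addEdge G v w v≢w) (addEdge H v w v≢w) × Isolated H v
  forestSwitch-addEdge {G} {H} iso (forestG , forestH , (a , b , c , d , distinct , ab , cd , ac , bd , H≗switch)) =
    (isForest-addEdge v≢w forestG (isolated⇒¬connected iso v≢w) ,
     isForest-addEdge v≢w forestH (isolated⇒¬connected isoH v≢w) ,
     (a , b , c , d , distinct ,
      isEdge (addEdge-⊆ {G = G} v≢w (edge ab)) , isEdge (addEdge-⊆ {G = G} v≢w (edge cd)) ,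
      cong₂ _∨_ ac (samePair-false (avoids v≢a v≢c)) , cong₂ _∨_ bd (samePair-false (avoids v≢b v≢d)) ,
      commute)) ,
    isoH
    where
    v≢a : v ≢ a
    v≢a refl = iso (edge ab)
    v≢b : v ≢ b
    v≢b refl = iso (edge-sym (edge ab))
    v≢c : v ≢ c
    v≢c refl = iso (edge cd)
    v≢d : v ≢ d
    v≢d refl = iso (edge-sym (edge cd))
    avoids : ∀ {x y} → v ≢ x → v ≢ y → ¬ SamePair x y v w
    avoids v≢x v≢y xy≐vw = ¬samePair-through xy≐vw v≢x v≢y (inj₁ (refl , refl))
    isoH : Isolated H v
    isoH {y} (edge e) = iso (edge (trans (sym (switchedAdj-away G a b c d v≢a v≢b v≢c v≢d y))
                                         (trans (sym (H≗switch v y)) e)))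
    commute : ∀ x y → adj (addEdge H v w v≢w) x y ≡ switchedAdj (addEdge G v w v≢w) a b c d x y
    commute x y = trans (cong (_∨ samePair x y v w) (H≗switch x y))
      (switchBool-∨ (samePair x y a b) (samePair x y c d) (samePair x y a c) (samePair x y b d) (adj G x y)
                    (samePair x y v w) λ t → let xy≐vw = samePair-sound {x = x} {y} t in
        samePair-false (¬samePair-through xy≐vw v≢a v≢b) ,
        samePair-false (¬samePair-through xy≐vw v≢c v≢d) ,
        samePair-false (¬samePair-through xy≐vw v≢a v≢c) ,
        samePair-false (¬samePair-through xy≐vw v≢b v≢d))

  star-addEdge : {G H : Graph n} → Isolated G v → Star ForestSwitch G H →
                 Star ForestSwitch (addEdge G v w v≢w) (addEdge H v w v≢w)
  star-addEdge iso ε = ε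
  star-addEdge iso (s ◅ ss) with s′ , iso′ ← forestSwitch-addEdge iso s = s′ ◅ star-addEdge iso′ ss

forestSwitch-respˡ : {G G′ H : Graph n} → SameGraph G G′ → ForestSwitch G H → ForestSwitch G′ H
forestSwitch-respˡ {G = G} {G′} same
                   (forestG , forestH , (a , b , c , d , distinct , ab , cd , ac , bd , H≗switch)) =
  isForest-⊆ (λ (edge e) → edge (trans (same _ _) e)) forestG , forestH ,
  (a , b , c , d , distinct , moved ab , moved cd , moved ac , moved bd ,
   λ x y → trans (H≗switch x y)
                 (cong (switchBool (samePair x y a b) (samePair x y c d) (samePair x y a c) (samePair x y b d))
                       (same x y)))
  where
  moved : ∀ {x y b} → adj G x y ≡ b → adj G′ x y ≡ b
  moved {x} {y} = trans (sym (same x y))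

star-respˡ : {G G′ H : Graph n} → SameGraph G G′ → Star ForestSwitch G H →
             ∃ λ H′ → Star ForestSwitch G′ H′ × SameGraph H′ H
star-respˡ {G′ = G′} same ε        = G′ , ε , λ x y → sym (same x y)
star-respˡ {H = H}   same (s ◅ ss) = H , forestSwitch-respˡ same s ◅ ss , λ _ _ → refl

Reachable : Graph n → Graph n → Set
Reachable {n} F F′ = Σ (Graph n) λ H → Star ForestSwitch F H × SameGraph H F′

reachable-prepend : {F F₁ F′ : Graph n} → Star ForestSwitch F F₁ → Reachable F₁ F′ → Reachable F F′
reachable-prepend F→F₁ (H , F₁→H , H≈F′) = H , F→F₁ ◅◅ F₁→H , H≈F′

reachable-addPendant : {F F′ : Graph n} {v w : Fin n} → Pendant F v w → Edge F′ v w →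
                       Reachable (deleteEdge F v w) (deleteEdge F′ v w) → Reachable F F′
reachable-addPendant {v = v} {w} pendant@(vw , _) vw′ (H , G→H , H≈G′)
  with H′ , F→H′ , H′≈H+vw ← star-respˡ (λ x y → sym (addEdge-deleteEdge (edge⇒≢ vw) vw x y))
                                          (star-addEdge (edge⇒≢ vw) (pendant⇒isolated pendant) G→H) =
  H′ , F→H′ , λ x y → trans (H′≈H+vw x y)
                            (trans (cong (_∨ samePair x y v w) (H≈G′ x y))
                                   (sym (addEdge-deleteEdge (edge⇒≢ vw) vw′ x y)))

edgeless-sameGraph : {G H : Graph n} → SameDegSeq G H → (∀ {x y} → ¬ Edge H x y) → SameGraph G H
edgeless-sameGraph {G = G} {H} same edgeless x y =
  trans (¬-not λ e → edgeless (proj₂ (edge-transfer {G = G} {H} same (edge e))))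
        (sym (¬-not (edgeless ∘ edge)))

reachable : (k : ℕ) {F F′ : Graph n} (support : List (Fin n)) → length support ≤ k →
            (∀ {x y} → Edge F′ x y → x ∈ support) →
            IsForest F → IsForest F′ → SameDegSeq F F′ → Reachable F F′
reachable k {F} {F′} support bound inSupport forest forest′ same with any?ᶠ (λ x → any?ᶠ (edge? F′ x))
... | no edgeless = F , ε , edgeless-sameGraph {G = F} {F′} same λ {x} {y} e → edgeless (x , y , e)
... | yes (_ , _ , xy) with findLeaf forest′ xy | k
...   | v , _ , (vw′ , _) , _ | zero = contradiction (ℕ.≤-trans (∈⇒1≤length (inSupport vw′)) bound) λ ()
...   | v , w , pendant′@(vw′ , _) , choice | suc k′
  with F₁ , F→F₁ , same₁ , forest₁ , vw₁ ← pendant-reachable forest same pendant′ choice =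
  reachable-prepend {F′ = F′} F→F₁
    (reachable-addPendant (pendant-transfer {G = F′} {F₁} (λ y → sym (same₁ y)) pendant′ vw₁) vw′
      (reachable k′ support′ shorter inSupport′
                 (isForest-⊆ deleteEdge-⊆ forest₁) (isForest-⊆ deleteEdge-⊆ forest′)
                 (deleteEdge-sameDegSeq vw₁ vw′ same₁)))
  where
  support′ : List (Fin _)
  support′ = filter (¬? ∘ (_≟ v)) support
  shorter : length support′ ≤ k′
  shorter = ℕ.≤-pred (ℕ.<-≤-trans (filter-notAll (¬? ∘ (_≟ v)) support
                                     (Any.map (λ { refl v≢v → v≢v refl }) (inSupport vw′))) bound)
  inSupport′ : ∀ {x y} → Edge (deleteEdge F′ v w) x y → x ∈ support′
  inSupport′ e =
    ∈-filter⁺ (¬? ∘ (_≟ v)) (inSupport (deleteEdge-⊆ e)) λ { refl → pendant⇒isolated pendant′ e }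

mainTheorem1 : (n : ℕ) (F F' : Graph n) →
    IsForest F → IsForest F' → SameDegSeq F F' →
    Σ (Graph n) λ H → Star ForestSwitch F H × SameGraph H F'
mainTheorem1 n F F' forest forest′ same =
  reachable n (allFin n) (ℕ.≤-reflexive (length-tabulate id)) (λ {x} _ → ∈-allFin x) forest forest′ same
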